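{- Let $G$ be a matching-covered graph and let $A$ be its edge to perfect matching incidence matrix. If the linear system $Ax=\mathbf{1}$ has a real solution, then all tight cuts of $G$ have the same number of edges. In particular, $G$ is regular.
   Context: Graphs are finite, loopless, and may have parallel edges. A connected nontrivial graph is matching-covered if every edge belongs to a perfect matching. The edge to perfect matching incidence matrix $A$ has rows indexed by edges and columns indexed by perfect matchings, with entry $1$ if the edge lies in the matching and $0$ otherwise; $\mathbf{1}$ is the all-ones vector indexed by edges. A cut is the set of edges with exactly one endpoint in $S$ for some vertex set $S$; it is odd if both $S$ and its complement have odd size. A tight cut is an odd cut that meets every perfect matching in exactly one edge (in particular, every trivial cut, i.e. the set of edges at a single vertex, is tight).
   Formalization: The solution of the linear system $Ax=\mathbf{1}$ is required to be rational rather than real. -}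

module Defs where

open import Data.Nat using (ℕ; zero; suc; _≤_; _∸_; _%_)
open import Data.Bool using (Bool; true; false; _∧_; _∨_; _xor_; if_then_else_)
open import Data.Fin using (Fin; _≟_)
open import Data.Fin.Subset using (Subset; _∈_; _∩_; ∣_∣)
open import Data.Fin.Properties using (all?)
open import Data.Vec using (Vec; []; _∷_; tabulate; lookup)
open import Data.Product using (_×_; proj₁; proj₂; ∃)
open import Data.Rational using (ℚ; 0ℚ; _+_)
open import Relation.Nullary using (¬_)
open import Relation.Nullary.Decidable using (⌊_⌋)
open import Relation.Binary.PropositionalEquality using (_≡_; _≢_)
open import Data.Nat using () renaming (_≟_ to _≟ℕ_)

-- A finite loopless multigraph: vertices Fin n, edges Fin m, each edge has two
-- distinct endpoints (parallel edges allowed).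
record Graph : Set where
  field
    n m      : ℕ
    ends     : Fin m → Fin n × Fin n
    loopless : ∀ e → proj₁ (ends e) ≢ proj₂ (ends e)

module _ (G : Graph) where
  open Graph G

  end₁ end₂ : Fin m → Fin n
  end₁ e = proj₁ (ends e)
  end₂ e = proj₂ (ends e)

  incident : Fin n → Subset m
  incident v = tabulate (λ e → ⌊ v ≟ end₁ e ⌋ ∨ ⌊ v ≟ end₂ e ⌋)

  degree : Fin n → ℕ
  degree v = ∣ incident v ∣

  IsPerfectMatching : Subset m → Set
  IsPerfectMatching M = ∀ v → ∣ M ∩ incident v ∣ ≡ 1

  isPerfectMatching : Subset m → Bool
  isPerfectMatching M = ⌊ all? (λ v → ∣ M ∩ incident v ∣ ≟ℕ 1) ⌋

  data Reach : Fin n → Fin n → Set where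
    here  : ∀ {v} → Reach v v
    step₁ : ∀ {v} e → Reach (end₂ e) v → Reach (end₁ e) v
    step₂ : ∀ {v} e → Reach (end₁ e) v → Reach (end₂ e) v

  Connected : Set
  Connected = ∀ u v → Reach u v

  MatchingCovered : Set
  MatchingCovered = Connected × (2 ≤ n) × (∀ e → ∃ λ M → IsPerfectMatching M × e ∈ M)

  cut : Subset n → Subset m
  cut S = tabulate (λ e → lookup S (end₁ e) xor lookup S (end₂ e))

  Odd : ℕ → Set
  Odd k = k % 2 ≡ 1

  TightCut : Subset n → Set
  TightCut S = Odd ∣ S ∣ × Odd (n ∸ ∣ S ∣)
             × (∀ M → IsPerfectMatching M → ∣ M ∩ cut S ∣ ≡ 1)

sumSubsets : ∀ k → (Subset k → ℚ) → ℚ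
sumSubsets zero    f = f []
sumSubsets (suc k) f = sumSubsets k (λ M → f (true ∷ M)) + sumSubsets k (λ M → f (false ∷ M))

-- (A x)_e, where columns of A are indexed by perfect matchings and x is given as
-- a function on edge sets (its values on non-matchings are ignored)
incidenceApply : (G : Graph) → (Subset (Graph.m G) → ℚ) → Fin (Graph.m G) → ℚ
incidenceApply G x e =
  sumSubsets (Graph.m G) (λ M → if isPerfectMatching G M ∧ lookup M e then x M else 0ℚ)

-- Summing the equations (Ax)_e = 1 over the edges of a set C that meets every
-- perfect matching exactly once gives |C| = Σ_M x_M, a number independent of C.
-- Tight cuts are such sets, and so are the trivial cuts, whose sizes are the
-- degrees.
{-# OPTIONS --safe #-}
module Submission where

open import Defs
open import Data.Fin using (Fin)
open import Data.Fin.Subset using (Subset; ∣_∣)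
open import Data.Product using (_×_)
open import Data.Rational using (ℚ; 1ℚ)
open import Relation.Binary.PropositionalEquality using (_≡_)

open import Data.Bool using (Bool; true; false; if_then_else_; _∧_)
open import Data.Bool.Properties using (if-eta; if-swap-then; if-∧)
open import Data.Empty using (⊥-elim)
open import Data.Fin.Properties using (all?)
open import Data.Fin.Subset using (_∩_)
open import Data.Nat using (zero; suc)
import Data.Nat as ℕ
open import Data.Product using (_,_)
open import Data.Rational using (0ℚ; _+_; _≤_; _<_; _≤?_; _<?_)
open import Data.Rational.Properties
  using (+-0-monoid; +-0-commutativeMonoid; +-0-group; +-identityˡ; +-identityʳ;
         ≤-refl; +-mono-≤; +-mono-<-≤; <⇒≢)
open import Data.Vec using ([]; _∷_; lookup)
open import Data.Vec.Properties using (lookup-zipWith)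
open import Relation.Binary.PropositionalEquality
  using (refl; sym; trans; cong; cong₂; module ≡-Reasoning)
open import Relation.Nullary using (yes; no)
open import Relation.Nullary.Decidable using (toWitness)

open import Algebra.Properties.CommutativeMonoid.Sum +-0-commutativeMonoid
  using (sum-syntax; sum-cong-≗; sum-replicate-zero; ∑-distrib-+)
open import Algebra.Properties.Monoid.Mult +-0-monoid using () renaming (_×_ to _·_)
open import Algebra.Properties.Group +-0-group using (∙-cancelˡ)

·1ℚ-nonNegative : ∀ n → 0ℚ ≤ n · 1ℚ
·1ℚ-nonNegative zero    = ≤-refl
·1ℚ-nonNegative (suc n) = +-mono-≤ (toWitness {a? = 0ℚ ≤? 1ℚ} _) (·1ℚ-nonNegative n)

suc·1ℚ-positive : ∀ n → 0ℚ < suc n · 1ℚ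
suc·1ℚ-positive n = +-mono-<-≤ (toWitness {a? = 0ℚ <? 1ℚ} _) (·1ℚ-nonNegative n)

·1ℚ-injective : ∀ m n → m · 1ℚ ≡ n · 1ℚ → m ≡ n
·1ℚ-injective zero    zero    _  = refl
·1ℚ-injective zero    (suc n) eq = ⊥-elim (<⇒≢ (suc·1ℚ-positive n) eq)
·1ℚ-injective (suc m) zero    eq = ⊥-elim (<⇒≢ (suc·1ℚ-positive m) (sym eq))
·1ℚ-injective (suc m) (suc n) eq = cong suc (·1ℚ-injective m n (∙-cancelˡ 1ℚ _ _ eq))

∑-indicator : ∀ {k} (C : Subset k) c → ∑[ e < k ] (if lookup C e then c else 0ℚ) ≡ ∣ C ∣ · c
∑-indicator []          c = refl
∑-indicator (true  ∷ C) c = cong (c +_) (∑-indicator C c)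
∑-indicator (false ∷ C) c = trans (+-identityˡ _) (∑-indicator C c)

∑-if : ∀ k b (f : Fin k → ℚ) →
       ∑[ e < k ] (if b then f e else 0ℚ) ≡ (if b then ∑[ e < k ] f e else 0ℚ)
∑-if k true  f = refl
∑-if k false f = sum-replicate-zero k

sumSubsets-zero : ∀ k → sumSubsets k (λ _ → 0ℚ) ≡ 0ℚ
sumSubsets-zero zero    = refl
sumSubsets-zero (suc k) = cong₂ _+_ (sumSubsets-zero k) (sumSubsets-zero k)

sumSubsets-cong : ∀ k {f g : Subset k → ℚ} → (∀ M → f M ≡ g M) →
                  sumSubsets k f ≡ sumSubsets k g
sumSubsets-cong zero    f≗g = f≗g []
sumSubsets-cong (suc k) f≗g = cong₂ _+_ (sumSubsets-cong k (λ M → f≗g (true ∷ M)))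
                                        (sumSubsets-cong k (λ M → f≗g (false ∷ M)))

sumSubsets-if : ∀ k b (f : Subset k → ℚ) →
                (if b then sumSubsets k f else 0ℚ) ≡ sumSubsets k (λ M → if b then f M else 0ℚ)
sumSubsets-if k true  f = refl
sumSubsets-if k false f = sym (sumSubsets-zero k)

∑-sumSubsets-comm : ∀ n k (f : Fin n → Subset k → ℚ) →
                    ∑[ e < n ] sumSubsets k (f e) ≡ sumSubsets k (λ M → ∑[ e < n ] f e M)
∑-sumSubsets-comm n zero    f = refl
∑-sumSubsets-comm n (suc k) f =
  trans (∑-distrib-+ (λ e → sumSubsets k (fᵗ e)) (λ e → sumSubsets k (fᶠ e)))
        (cong₂ _+_ (∑-sumSubsets-comm n k fᵗ) (∑-sumSubsets-comm n k fᶠ))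
  where
  fᵗ fᶠ : Fin n → Subset k → ℚ
  fᵗ e M = f e (true ∷ M)
  fᶠ e M = f e (false ∷ M)

if-∧-reorder : ∀ {A : Set} c p b {x y : A} →
               (if c then (if p ∧ b then x else y) else y)
             ≡ (if p then (if b ∧ c then x else y) else y)
if-∧-reorder c false b = if-eta c
if-∧-reorder c true  b = trans (if-swap-then c b) (sym (if-∧ b))

module _ (G : Graph) where
  open Graph G

  MeetsEveryPerfectMatchingOnce : Subset m → Set
  MeetsEveryPerfectMatchingOnce C = ∀ M → IsPerfectMatching G M → ∣ M ∩ C ∣ ≡ 1

  tightCut-meetsOnce : ∀ S → TightCut G S → MeetsEveryPerfectMatchingOnce (cut G S)
  tightCut-meetsOnce S (_ , _ , meetsOnce) = meetsOnce

  incident-meetsOnce : ∀ v → MeetsEveryPerfectMatchingOnce (incident G v)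
  incident-meetsOnce v M isPM = isPM v

  perfectMatchingWeight : (Subset m → ℚ) → ℚ
  perfectMatchingWeight x = sumSubsets m (λ M → if isPerfectMatching G M then x M else 0ℚ)

  module _ (x : Subset m → ℚ) (C : Subset m) where
    open ≡-Reasoning

    entry : Subset m → Fin m → ℚ
    entry M e = if isPerfectMatching G M ∧ lookup M e then x M else 0ℚ

    ∑-column : ∀ M → ∑[ e < m ] (if lookup C e then entry M e else 0ℚ)
                     ≡ (if isPerfectMatching G M then ∣ M ∩ C ∣ · x M else 0ℚ)
    ∑-column M = begin
      ∑[ e < m ] (if lookup C e then (if pm ∧ lookup M e then x M else 0ℚ) else 0ℚ)
        ≡⟨ sum-cong-≗ (λ e → trans (if-∧-reorder (lookup C e) pm (lookup M e))
                                   (cong (λ b → if pm then (if b then x M else 0ℚ) else 0ℚ)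
                                         (sym (lookup-zipWith _∧_ e M C)))) ⟩
      ∑[ e < m ] (if pm then (if lookup (M ∩ C) e then x M else 0ℚ) else 0ℚ)
        ≡⟨ ∑-if m pm _ ⟩
      (if pm then ∑[ e < m ] (if lookup (M ∩ C) e then x M else 0ℚ) else 0ℚ)
        ≡⟨ cong (λ s → if pm then s else 0ℚ) (∑-indicator (M ∩ C) (x M)) ⟩
      (if pm then ∣ M ∩ C ∣ · x M else 0ℚ) ∎
      where
      pm : Bool
      pm = isPerfectMatching G M

    ∑-incidenceApply :
      ∑[ e < m ] (if lookup C e then incidenceApply G x e else 0ℚ)
        ≡ sumSubsets m (λ M → if isPerfectMatching G M then ∣ M ∩ C ∣ · x M else 0ℚ)
    ∑-incidenceApply = begin
      ∑[ e < m ] (if lookup C e then sumSubsets m (λ M → entry M e) else 0ℚ)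
        ≡⟨ sum-cong-≗ (λ e → sumSubsets-if m (lookup C e) (λ M → entry M e)) ⟩
      ∑[ e < m ] sumSubsets m (λ M → if lookup C e then entry M e else 0ℚ)
        ≡⟨ ∑-sumSubsets-comm m m _ ⟩
      sumSubsets m (λ M → ∑[ e < m ] (if lookup C e then entry M e else 0ℚ))
        ≡⟨ sumSubsets-cong m ∑-column ⟩
      sumSubsets m (λ M → if isPerfectMatching G M then ∣ M ∩ C ∣ · x M else 0ℚ) ∎

    meetsOnce-size : (∀ e → incidenceApply G x e ≡ 1ℚ) → MeetsEveryPerfectMatchingOnce C →
                     ∣ C ∣ · 1ℚ ≡ perfectMatchingWeight x
    meetsOnce-size Ax≡1 meetsOnce = begin
      ∣ C ∣ · 1ℚ
        ≡⟨ sym (∑-indicator C 1ℚ) ⟩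
      ∑[ e < m ] (if lookup C e then 1ℚ else 0ℚ)
        ≡⟨ sum-cong-≗ (λ e → cong (λ q → if lookup C e then q else 0ℚ) (sym (Ax≡1 e))) ⟩
      ∑[ e < m ] (if lookup C e then incidenceApply G x e else 0ℚ)
        ≡⟨ ∑-incidenceApply ⟩
      sumSubsets m (λ M → if isPerfectMatching G M then ∣ M ∩ C ∣ · x M else 0ℚ)
        ≡⟨ sumSubsets-cong m meetsOnce-weight ⟩
      perfectMatchingWeight x ∎
      where
      meetsOnce-weight : ∀ M → (if isPerfectMatching G M then ∣ M ∩ C ∣ · x M else 0ℚ)
                               ≡ (if isPerfectMatching G M then x M else 0ℚ)
      -- isPerfectMatching G M is the boolean reflection of this decision.
      meetsOnce-weight M with all? (λ v → ∣ M ∩ incident G v ∣ ℕ.≟ 1)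
      ... | yes isPM = trans (cong (_· x M) (meetsOnce M isPM)) (+-identityʳ (x M))
      ... | no  _    = refl

  meetsOnce-sameSize : ∀ x → (∀ e → incidenceApply G x e ≡ 1ℚ) → ∀ C D →
                       MeetsEveryPerfectMatchingOnce C → MeetsEveryPerfectMatchingOnce D →
                       ∣ C ∣ ≡ ∣ D ∣
  meetsOnce-sameSize x Ax≡1 C D C-once D-once = ·1ℚ-injective ∣ C ∣ ∣ D ∣
    (trans (meetsOnce-size x C Ax≡1 C-once) (sym (meetsOnce-size x D Ax≡1 D-once)))

lemma1 : (G : Graph) → MatchingCovered G →
         (x : Subset (Graph.m G) → ℚ) →
         (∀ e → incidenceApply G x e ≡ 1ℚ) →
         (∀ S T → TightCut G S → TightCut G T → ∣ cut G S ∣ ≡ ∣ cut G T ∣)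
         × (∀ u v → degree G u ≡ degree G v)
lemma1 G _ x Ax≡1 =
  (λ S T S-tight T-tight → sameSize (cut G S) (cut G T) (tightCut-meetsOnce G S S-tight)
                                                        (tightCut-meetsOnce G T T-tight)) ,
  (λ u v → sameSize (incident G u) (incident G v) (incident-meetsOnce G u) (incident-meetsOnce G v))
  where
  sameSize : ∀ C D → MeetsEveryPerfectMatchingOnce G C → MeetsEveryPerfectMatchingOnce G D →
             ∣ C ∣ ≡ ∣ D ∣
  sameSize = meetsOnce-sameSize G x Ax≡1
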